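{- Let $\mathcal{P}=\mathcal{P}_o\uplus\mathcal{P}_u$, let $\varphi,\psi\in\mathsf{LTL_f}(\mathcal{P})$ with $\varphi\sim\psi$, let $w_o\in\mathbb{B}^{\mathcal{P}_o}$, and let $\varphi'$ and $\psi'$ be the first components of $\mathrm{fp}_{\mathrm{obs}}(\varphi,w_o)$ and $\mathrm{fp}_{\mathrm{obs}}(\psi,w_o)$ respectively. Then $\varphi'\sim\psi'$.
   Context: $\mathbb{B}=\{\bot,\top\}$; assignments $w:\mathcal{P}\to\mathbb{B}$ (identified with the set of true propositions), restriction $w|_{\mathcal{P}_o}$. $\mathsf{LTL_f}(\mathcal{P})$ formulas: $\varphi::=\mathit{tt}\mid\mathit{ff}\mid p\mid\neg\varphi\mid\varphi\odot\varphi\mid \mathsf{X}\varphi\mid\mathsf{X}^{s}\varphi\mid\mathsf{F}\varphi\mid\mathsf{G}\varphi\mid\varphi\,\mathsf{U}\,\varphi\mid\varphi\,\mathsf{R}\,\varphi$ ($p\in\mathcal{P}$, $\odot$ a binary Boolean connective; $\mathsf{X}$ weak next, $\mathsf{X}^s$ strong next). Propositional equivalence: for $\varphi$, let $\varphi_P$ be the Boolean formula obtained by replacing each maximal temporal subformula $\psi$ (subformula whose main operator is temporal and not strictly inside another temporal subformula) by a fresh Boolean variable $x_\psi$; $\varphi_1\sim\varphi_2$ iff ${\varphi_1}_P,{\varphi_2}_P$ are semantically equivalent Boolean formulas. $[\varphi]_\sim$ is a fixed unique representative of the $\sim$-class of $\varphi$. Pairs in $\mathsf{LTL_f}(\mathcal{P})\times\mathbb{B}$: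 $(\varphi_1,b_1)\odot(\varphi_2,b_2)=([\varphi_1\odot\varphi_2]_\sim,b_1\odot b_2)$, $\neg(\varphi,b)=([\neg\varphi]_\sim,\neg b)$, and $\bigwedge X=(\bigwedge_{(\varphi,b)\in X}\varphi,\bigwedge_{(\varphi,b)\in X}b)$ for nonempty finite $X$. Formula progression $\mathrm{fp}(\varphi,w)$, $w\in\mathbb{B}^{\mathcal{P}}$: $\mathrm{fp}(\mathit{tt},w)=(\mathit{tt},\top)$, $\mathrm{fp}(\mathit{ff},w)=(\mathit{ff},\bot)$; $\mathrm{fp}(p,w)=(\mathit{tt},\top)$ if $p\in w$, else $(\mathit{ff},\bot)$; $\mathrm{fp}(\neg\varphi,w)=\neg\mathrm{fp}(\varphi,w)$; $\mathrm{fp}(\varphi_1\odot\varphi_2,w)=\mathrm{fp}(\varphi_1,w)\odot\mathrm{fp}(\varphi_2,w)$; $\mathrm{fp}(\mathsf{X}\varphi,w)=(\varphi,\top)$; $\mathrm{fp}(\mathsf{X}^s\varphi,w)=(\varphi,\bot)$; $\mathrm{fp}(\mathsf{F}\varphi,w)=\mathrm{fp}(\varphi,w)\vee(\mathsf{F}\varphi,\bot)$; $\mathrm{fp}(\mathsf{G}\varphi,w)=\mathrm{fp}(\varphi,w)\wedge(\mathsf{G}\varphi,\top)$; $\mathrm{fp}(\varphi_1\mathsf{U}\varphi_2,w)=\mathrm{fp}(\varphi_2,w)\vee(\mathrm{fp}(\varphi_1,w)\wedge(\varphi_1\mathsf{U}\varphi_2,\bot))$; $\mathrm{fp}(\varphi_1\mathsf{R}\varphi_2,w)=\mathrm{fp}(\varphi_2,w)\wedge(\mathrm{fp}(\varphi_1,w)\vee(\varphi_1\mathsf{R}\varphi_2,\top))$.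 Observable progression: $\mathrm{fp}_{\mathrm{obs}}(\psi,w_o)=\bigwedge\{\mathrm{fp}(\psi,w)\mid w\in\mathbb{B}^{\mathcal{P}},\ w|_{\mathcal{P}_o}=w_o\}$. -}

module Defs where

open import Data.Bool using (Bool; true; false; not; _∧_; _∨_)
open import Data.Fin using (Fin; zero; suc)
open import Data.Nat using (ℕ; zero; suc)
open import Data.Sum using (_⊎_; inj₁; inj₂)
open import Data.Product using (_×_; _,_; proj₁; proj₂)
open import Data.List.NonEmpty as L⁺ using (List⁺; _∷_; [_])
open import Relation.Binary.PropositionalEquality using (_≡_)

-- LTLf formulas over a set P of atomic propositions.
-- `bin f φ ψ` is φ ⊙ ψ for the binary Boolean connective ⊙ with truth table f.
data Formula (P : Set) : Set where
  tt ff : Formula P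
  var   : P → Formula P
  neg   : Formula P → Formula P
  bin   : (Bool → Bool → Bool) → Formula P → Formula P → Formula P
  X Xs F G : Formula P → Formula P
  _U_ _R_ : Formula P → Formula P → Formula P

module _ {P : Set} where

  -- Evaluation of the Boolean abstraction φ_P: atoms are read from v,
  -- every maximal temporal subformula ψ is the Boolean variable x_ψ = t ψ.
  evalP : (P → Bool) → (Formula P → Bool) → Formula P → Bool
  evalP v t tt = true
  evalP v t ff = false
  evalP v t (var p) = v p
  evalP v t (neg φ) = not (evalP v t φ)
  evalP v t (bin f φ ψ) = f (evalP v t φ) (evalP v t ψ)
  evalP v t φ@(X _) = t φ
  evalP v t φ@(Xs _) = t φ
  evalP v t φ@(F _) = t φ
  evalP v t φ@(G _) = t φ
  evalP v t φ@(_ U _) = t φ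
  evalP v t φ@(_ R _) = t φ

  _∼_ : Formula P → Formula P → Set
  φ₁ ∼ φ₂ = ∀ (v : P → Bool) (t : Formula P → Bool) → evalP v t φ₁ ≡ evalP v t φ₂

record Rep (P : Set) : Set where
  field
    [_]∼    : Formula P → Formula P
    rep-∼   : ∀ φ → [ φ ]∼ ∼ φ
    rep-uniq : ∀ φ ψ → φ ∼ ψ → [ φ ]∼ ≡ [ ψ ]∼

module Pairs {P : Set} (ρ : Rep P) where
  open Rep ρ

  Pair : Set
  Pair = Formula P × Bool

  binP : (Bool → Bool → Bool) → Pair → Pair → Pair
  binP f (φ₁ , b₁) (φ₂ , b₂) = [ bin f φ₁ φ₂ ]∼ , f b₁ b₂

  negP : Pair → Pair
  negP (φ , b) = [ neg φ ]∼ , not b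

  _∧P_ _∨P_ : Pair → Pair → Pair
  _∧P_ = binP _∧_
  _∨P_ = binP _∨_

  -- ⋀X for a nonempty finite collection (conjunction of the components,
  -- no normalisation by [_]∼), taken in the listed order.
  ⋀ : List⁺ Pair → Pair
  ⋀ xs = L⁺.foldr₁ (bin _∧_) (L⁺.map proj₁ xs) , L⁺.foldr₁ _∧_ (L⁺.map proj₂ xs)

  fp : Formula P → (P → Bool) → Pair
  fp tt w = tt , true
  fp ff w = ff , false
  fp (var p) w with w p
  ... | true = tt , true
  ... | false = ff , false
  fp (neg φ) w = negP (fp φ w)
  fp (bin f φ₁ φ₂) w = binP f (fp φ₁ w) (fp φ₂ w)
  fp (X φ) w = φ , true
  fp (Xs φ) w = φ , false
  fp (F φ) w = fp φ w ∨P (F φ , false)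
  fp (G φ) w = fp φ w ∧P (G φ , true)
  fp (φ₁ U φ₂) w = fp φ₂ w ∨P (fp φ₁ w ∧P ((φ₁ U φ₂) , false))
  fp (φ₁ R φ₂) w = fp φ₂ w ∧P (fp φ₁ w ∨P ((φ₁ R φ₂) , true))

extend : ∀ {n} → Bool → (Fin n → Bool) → Fin (suc n) → Bool
extend b f zero = b
extend b f (suc i) = f i

allAssign : (n : ℕ) → List⁺ (Fin n → Bool)
allAssign zero = [ (λ ()) ]
allAssign (suc n) = L⁺.concatMap (λ f → extend false f ∷ (extend true f L∷ []) ) (allAssign n)
  where open import Data.List using ([]) renaming (_∷_ to _L∷_)

-- 𝒫 = 𝒫_o ⊎ 𝒫_u with 𝒫_o = Fin m, 𝒫_u = Fin n.
combine : ∀ {m n} → (Fin m → Bool) → (Fin n → Bool) → (Fin m ⊎ Fin n → Bool)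
combine wo wu (inj₁ i) = wo i
combine wo wu (inj₂ j) = wu j

fpObs : ∀ {m n} → Rep (Fin m ⊎ Fin n) → Formula (Fin m ⊎ Fin n) → (Fin m → Bool) → Formula (Fin m ⊎ Fin n) × Bool
fpObs {m} {n} ρ ψ wo = ⋀ (L⁺.map (λ wu → fp ψ (combine wo wu)) (allAssign n))
  where open Pairs ρ

{-# OPTIONS --safe #-}
-- Evaluating the first component of fp(φ, w) under the Boolean abstraction
-- gives the abstraction of φ itself, evaluated with the atoms read from w and
-- each maximal temporal subformula χ interpreted by the value of fp(χ, w);
-- the representatives [_]∼ are invisible to evaluation. So progression by a
-- single assignment respects ∼, and fp_obs, a conjunction of such
-- progressions over the same assignments, respects it conjunct by conjunct.
module Submission where

open import Defs
open import Data.Nat using (ℕ)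
open import Data.Fin using (Fin)
open import Data.Bool using (Bool; true; false; not; _∧_)
open import Data.Sum using (_⊎_)
open import Data.Product using (proj₁)
open import Data.List using ([]; _∷_)
open import Data.List.NonEmpty as L⁺ using (_∷_)
open import Relation.Binary.PropositionalEquality using (_≡_; refl; trans; sym; cong; cong₂)

bin-resp-∼ : ∀ {P : Set} f (φ₁ φ₂ ψ₁ ψ₂ : Formula P) →
  φ₁ ∼ ψ₁ → φ₂ ∼ ψ₂ → bin f φ₁ φ₂ ∼ bin f ψ₁ ψ₂
bin-resp-∼ f _ _ _ _ φ₁∼ψ₁ φ₂∼ψ₂ v t = cong₂ f (φ₁∼ψ₁ v t) (φ₂∼ψ₂ v t)

module _ {P : Set} (ρ : Rep P) where
  open Rep ρ
  open Pairs ρ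

  evalP-fp : ∀ v t w φ →
    evalP v t (proj₁ (fp φ w)) ≡ evalP w (λ χ → evalP v t (proj₁ (fp χ w))) φ
  evalP-fp v t w tt = refl
  evalP-fp v t w ff = refl
  evalP-fp v t w (var p) with w p
  ... | true = refl
  ... | false = refl
  evalP-fp v t w (neg φ) = trans (rep-∼ _ v t) (cong not (evalP-fp v t w φ))
  evalP-fp v t w (bin f φ₁ φ₂) =
    trans (rep-∼ _ v t) (cong₂ f (evalP-fp v t w φ₁) (evalP-fp v t w φ₂))
  evalP-fp v t w (X φ) = refl
  evalP-fp v t w (Xs φ) = refl
  evalP-fp v t w (F φ) = refl
  evalP-fp v t w (G φ) = refl
  evalP-fp v t w (φ₁ U φ₂) = refl
  evalP-fp v t w (φ₁ R φ₂) = refl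

  fp-resp-∼ : ∀ φ ψ → φ ∼ ψ → ∀ w → proj₁ (fp φ w) ∼ proj₁ (fp ψ w)
  fp-resp-∼ φ ψ φ∼ψ w v t =
    trans (evalP-fp v t w φ) (trans (φ∼ψ w _) (sym (evalP-fp v t w ψ)))

  ⋀-map-resp-∼ : ∀ {A : Set} (h k : A → Pair) →
    (∀ a → proj₁ (h a) ∼ proj₁ (k a)) →
    ∀ xs → proj₁ (⋀ (L⁺.map h xs)) ∼ proj₁ (⋀ (L⁺.map k xs))
  ⋀-map-resp-∼ h k h∼k (x ∷ xs) = conj x xs
    where
    conj : ∀ x xs → proj₁ (⋀ (L⁺.map h (x ∷ xs))) ∼ proj₁ (⋀ (L⁺.map k (x ∷ xs)))
    conj x [] = h∼k x
    conj x (y ∷ ys) =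
      bin-resp-∼ _∧_ (proj₁ (h x)) (proj₁ (⋀ (L⁺.map h (y ∷ ys))))
                     (proj₁ (k x)) (proj₁ (⋀ (L⁺.map k (y ∷ ys))))
                     (h∼k x) (conj y ys)

lemma2 : ∀ {m n : ℕ} (ρ : Rep (Fin m ⊎ Fin n)) (φ ψ : Formula (Fin m ⊎ Fin n)) →
    φ ∼ ψ → (wo : Fin m → Bool) →
    proj₁ (fpObs ρ φ wo) ∼ proj₁ (fpObs ρ ψ wo)
lemma2 {n = n} ρ φ ψ φ∼ψ wo =
  ⋀-map-resp-∼ ρ (λ wu → fp φ (combine wo wu)) (λ wu → fp ψ (combine wo wu))
    (λ wu → fp-resp-∼ ρ φ ψ φ∼ψ (combine wo wu)) (allAssign n)
  where open Pairs ρ using (fp)
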